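{- Consider a row of $n\ge 1$ seats with a single entrance at one end, filled by selfish theatregoers who choose seats uniformly at random among the accessible empty seats (model described in the context). The expected number of occupied seats when the process ends equals $H_n=\sum_{k=1}^n \frac1k$, the $n$th harmonic number.
   Context: Row model: a row consists of $n$ seats numbered $1,\dots,n$ from left to right, with a single entrance at the left end (next to seat 1). Theatregoers arrive one at a time. A selfish theatregoer, once seated, never gets up, so no later theatregoer can walk past her seat. An empty seat is accessible if it can be reached from the entrance without passing a seat occupied by a selfish theatregoer. Each arriving theatregoer sits in an accessible empty seat chosen uniformly at random among all accessible empty seats; the process ends when no accessible empty seat remains. Here all theatregoers are selfish. -}

module Defs where

open import Data.Bool using (Bool; true; false)
open import Data.Nat using (ℕ; zero; suc)
open import Data.Integer using (+_)
open import Data.Fin using (Fin; zero; suc)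
open import Data.List using (List; []; _∷_; map; length; foldr)
open import Data.Vec using (Vec; []; _∷_; _[_]≔_)
open import Data.Rational using (ℚ; 0ℚ; _+_; _*_; _/_)

-- A configuration of a row of n seats: seat i (Fin n, i.e. seat i+1 counted
-- from the entrance) is occupied iff the entry is true.
Config : ℕ → Set
Config n = Vec Bool n

-- Accessible empty seats: empty seats reachable from the entrance (left end)
-- without passing an occupied (selfish) seat, i.e. the leading run of empty seats.
accessible : ∀ {n} → Config n → List (Fin n)
accessible []          = []
accessible (true ∷ _)  = []
accessible (false ∷ c) = zero ∷ map suc (accessible c)

occupy : ∀ {n} → Config n → Fin n → Config n
occupy c i = c [ i ]≔ true

occupied : ∀ {n} → Config n → ℕ
occupied []          = 0
occupied (true ∷ c)  = suc (occupied c)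
occupied (false ∷ c) = occupied c

sumℚ : List ℚ → ℚ
sumℚ = foldr _+_ 0ℚ

-- The first argument is fuel (number of remaining arrivals allowed); since each
-- arrival fills an empty seat, fuel n suffices for a row of n seats.
expectedFinal : ∀ {n} → ℕ → Config n → ℚ
expectedFinal zero c = + occupied c / 1
expectedFinal (suc f) c with accessible c
... | []     = + occupied c / 1
... | s ∷ ss = (+ 1 / suc (length ss)) *
               sumℚ (map (λ t → expectedFinal f (occupy c t)) (s ∷ ss))

harmonic : ℕ → ℚ
harmonic zero    = 0ℚ
harmonic (suc k) = harmonic k + (+ 1 / suc k)

module Submission where

open import Defs
open import Data.Nat using (ℕ; _≤_)
open import Data.Bool using (false)
open import Data.Vec using (replicate)
open import Relation.Binary.PropositionalEquality using (_≡_)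

open import Data.Nat using (zero; suc; _<_; z<s; s<s)
open import Data.Nat.Properties using (n≤0⇒n≡0; ≤-pred; ≤-trans; ≤-reflexive)
  renaming (+-identityʳ to ℕ-+-identityʳ)
open import Data.Bool using (true)
open import Data.Vec using ([]; _∷_)
open import Data.Fin using (Fin; toℕ)
import Data.Fin as Fin
open import Function using (_∘′_)
open import Data.List using ([]; _∷_; [_]; _∷ʳ_; map; length; upTo; applyUpTo)
open import Data.List.Properties using (map-++; map-∘; length-map; map-cong-local; upTo-∷ʳ; map-upTo)
open import Data.List.Relation.Unary.All as All using (All; []; _∷_)
open import Data.List.Relation.Unary.All.Properties using (map⁺)
open import Data.Integer using (+_) renaming (_+_ to _ℤ+_)
import Data.Integer.Properties as ℤ
open import Data.Rational using (ℚ; 1ℚ; _+_; _*_; _/_; fromℚᵘ)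
open import Data.Rational.Properties
  using (toℚᵘ-injective; toℚᵘ-fromℚᵘ; fromℚᵘ-cong; toℚᵘ-homo-+; toℚᵘ-homo-*;
         +-identityˡ; +-identityʳ; +-assoc; *-assoc; *-comm; *-identityˡ; *-zeroˡ)
import Data.Rational.Unnormalised as ℚᵘ
import Data.Rational.Unnormalised.Properties as ℚᵘ
open import Data.Rational.Solver using (module +-*-Solver)
open import Relation.Binary.PropositionalEquality using (refl; sym; trans; cong; cong₂)
open Relation.Binary.PropositionalEquality.≡-Reasoning

-- Call the leading block of empty seats of a configuration c its
-- run; let k be its length and o the number of occupied seats.  We show that,
-- with at least k units of fuel,
--     expectedFinal c = H_k + o.
-- The next theatregoer picks a seat t < k of the run uniformly; afterwards the
-- run is cut to length t and o grows by one, so by induction on the fuel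
--     expectedFinal c = (1/k) Σ_{t<k} (H_t + o + 1),
-- and the harmonic identity Σ_{t<k} (H_t + o + 1) = k (H_k + o) closes the
-- induction.  The empty row of n seats has k = n and o = 0, giving H_n.

⟦_⟧ : ℕ → ℚ
⟦ m ⟧ = + m / 1

fromℚᵘ-homo-+ : ∀ p q → fromℚᵘ (p ℚᵘ.+ q) ≡ fromℚᵘ p + fromℚᵘ q
fromℚᵘ-homo-+ p q = toℚᵘ-injective (ℚᵘ.≃-trans (toℚᵘ-fromℚᵘ (p ℚᵘ.+ q))
  (ℚᵘ.≃-trans (ℚᵘ.+-cong (ℚᵘ.≃-sym (toℚᵘ-fromℚᵘ p)) (ℚᵘ.≃-sym (toℚᵘ-fromℚᵘ q)))
              (ℚᵘ.≃-sym (toℚᵘ-homo-+ (fromℚᵘ p) (fromℚᵘ q)))))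

fromℚᵘ-homo-* : ∀ p q → fromℚᵘ (p ℚᵘ.* q) ≡ fromℚᵘ p * fromℚᵘ q
fromℚᵘ-homo-* p q = toℚᵘ-injective (ℚᵘ.≃-trans (toℚᵘ-fromℚᵘ (p ℚᵘ.* q))
  (ℚᵘ.≃-trans (ℚᵘ.*-cong (ℚᵘ.≃-sym (toℚᵘ-fromℚᵘ p)) (ℚᵘ.≃-sym (toℚᵘ-fromℚᵘ q)))
              (ℚᵘ.≃-sym (toℚᵘ-homo-* (fromℚᵘ p) (fromℚᵘ q)))))

⟦suc⟧ : ∀ m → ⟦ suc m ⟧ ≡ 1ℚ + ⟦ m ⟧
⟦suc⟧ m = trans (fromℚᵘ-cong fraction-identity)
                (fromℚᵘ-homo-+ ℚᵘ.1ℚᵘ (ℚᵘ.mkℚᵘ (+ m) 0))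
  where
  -- (m + 1)/1 = 1/1 + m/1; cross-multiplied, both sides are m + 1.
  fraction-identity : ℚᵘ.mkℚᵘ (+ suc m) 0 ℚᵘ.≃ ℚᵘ.1ℚᵘ ℚᵘ.+ ℚᵘ.mkℚᵘ (+ m) 0
  fraction-identity = ℚᵘ.*≡* (trans (ℤ.*-identityʳ (+ suc m))
    (sym (trans (ℤ.*-identityʳ _) (cong ((+ 1) ℤ+_) (ℤ.*-identityʳ (+ m))))))

⟦suc⟧-inverse : ∀ k → ⟦ suc k ⟧ * (+ 1 / suc k) ≡ 1ℚ
⟦suc⟧-inverse k = trans (sym (fromℚᵘ-homo-* (ℚᵘ.mkℚᵘ (+ suc k) 0) (ℚᵘ.mkℚᵘ (+ 1) k)))
                        (fromℚᵘ-cong fraction-identity)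
  where
  -- (k + 1)/1 · 1/(k + 1) = 1/1; cross-multiplied, both sides are k + 1.
  fraction-identity : ℚᵘ.mkℚᵘ (+ suc k) 0 ℚᵘ.* ℚᵘ.mkℚᵘ (+ 1) k ℚᵘ.≃ ℚᵘ.1ℚᵘ
  fraction-identity = ℚᵘ.*≡* (trans (ℤ.*-identityʳ _)
    (trans (ℤ.*-identityʳ (+ suc k))
           (sym (trans (ℤ.*-identityˡ _) (cong (λ d → + suc d) (ℕ-+-identityʳ k))))))

sumℚ-∷ʳ : ∀ xs x → sumℚ (xs ∷ʳ x) ≡ sumℚ xs + x
sumℚ-∷ʳ []       x = trans (+-identityʳ x) (sym (+-identityˡ x))
sumℚ-∷ʳ (y ∷ xs) x = trans (cong (_+_ y) (sumℚ-∷ʳ xs x)) (sym (+-assoc y (sumℚ xs) x))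

harmonic-step : ∀ K H o r → (1ℚ + K) * r ≡ 1ℚ →
                K * (H + o) + (H + (1ℚ + o)) ≡ (1ℚ + K) * ((H + r) + o)
harmonic-step K H o r inverse = begin
  K * (H + o) + (H + (1ℚ + o))              ≡⟨ regroup-left K H o ⟩
  (1ℚ + K) * (H + o) + 1ℚ                   ≡⟨ cong (_+_ ((1ℚ + K) * (H + o))) (sym inverse) ⟩
  (1ℚ + K) * (H + o) + (1ℚ + K) * r         ≡⟨ regroup-right K H o r ⟩
  (1ℚ + K) * ((H + r) + o)                  ∎
  where
  open +-*-Solver using (solve; _:=_; _:+_; _:*_; con)
  regroup-left : ∀ K H o → K * (H + o) + (H + (1ℚ + o)) ≡ (1ℚ + K) * (H + o) + 1ℚ
  regroup-left = solve 3 (λ K H o →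
    K :* (H :+ o) :+ (H :+ (con 1ℚ :+ o)) := (con 1ℚ :+ K) :* (H :+ o) :+ con 1ℚ) refl
  regroup-right : ∀ K H o r → (1ℚ + K) * (H + o) + (1ℚ + K) * r ≡ (1ℚ + K) * ((H + r) + o)
  regroup-right = solve 4 (λ K H o r →
    (con 1ℚ :+ K) :* (H :+ o) :+ (con 1ℚ :+ K) :* r := (con 1ℚ :+ K) :* ((H :+ r) :+ o)) refl

-- The harmonic identity, shifted by o:  Σ_{i<k} (H_i + (o + 1)) = k (H_k + o).
-- (For o = 0 this is the classical Σ_{i<k} H_i = k H_k − k.)
harmonic-sum : ∀ o k →
  sumℚ (map (λ i → harmonic i + ⟦ suc o ⟧) (upTo k)) ≡ ⟦ k ⟧ * (harmonic k + ⟦ o ⟧)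
harmonic-sum o zero    = sym (*-zeroˡ (harmonic zero + ⟦ o ⟧))
harmonic-sum o (suc k) = begin
  sumℚ (map g (upTo (suc k)))          ≡⟨ cong (λ xs → sumℚ (map g xs)) (sym (upTo-∷ʳ k)) ⟩
  sumℚ (map g (upTo k ∷ʳ k))           ≡⟨ cong sumℚ (map-++ g (upTo k) [ k ]) ⟩
  sumℚ (map g (upTo k) ∷ʳ g k)         ≡⟨ sumℚ-∷ʳ (map g (upTo k)) (g k) ⟩
  sumℚ (map g (upTo k)) + g k
    ≡⟨ cong₂ (λ s o′ → s + (harmonic k + o′)) (harmonic-sum o k) (⟦suc⟧ o) ⟩
  ⟦ k ⟧ * (harmonic k + ⟦ o ⟧) + (harmonic k + (1ℚ + ⟦ o ⟧))
    ≡⟨ harmonic-step ⟦ k ⟧ (harmonic k) ⟦ o ⟧ (+ 1 / suc k) inverse ⟩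
  (1ℚ + ⟦ k ⟧) * (harmonic (suc k) + ⟦ o ⟧)
    ≡⟨ cong (_* (harmonic (suc k) + ⟦ o ⟧)) (sym (⟦suc⟧ k)) ⟩
  ⟦ suc k ⟧ * (harmonic (suc k) + ⟦ o ⟧) ∎
  where
  g : ℕ → ℚ
  g i = harmonic i + ⟦ suc o ⟧
  inverse : (1ℚ + ⟦ k ⟧) * (+ 1 / suc k) ≡ 1ℚ
  inverse = trans (cong (_* (+ 1 / suc k)) (sym (⟦suc⟧ k))) (⟦suc⟧-inverse k)

harmonic-average : ∀ o m →
  (+ 1 / suc m) * sumℚ (map (λ i → harmonic i + ⟦ suc o ⟧) (upTo (suc m)))
    ≡ harmonic (suc m) + ⟦ o ⟧
harmonic-average o m = begin
  (+ 1 / suc m) * sumℚ (map (λ i → harmonic i + ⟦ suc o ⟧) (upTo (suc m)))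
    ≡⟨ cong ((+ 1 / suc m) *_) (harmonic-sum o (suc m)) ⟩
  (+ 1 / suc m) * (⟦ suc m ⟧ * X)  ≡⟨ sym (*-assoc (+ 1 / suc m) ⟦ suc m ⟧ X) ⟩
  (+ 1 / suc m) * ⟦ suc m ⟧ * X
    ≡⟨ cong (_* X) (trans (*-comm (+ 1 / suc m) ⟦ suc m ⟧) (⟦suc⟧-inverse m)) ⟩
  1ℚ * X                           ≡⟨ *-identityˡ X ⟩
  X                                ∎
  where
  X : ℚ
  X = harmonic (suc m) + ⟦ o ⟧

runLength : ∀ {n} → Config n → ℕ
runLength c = length (accessible c)

accessible-indices : ∀ {n} (c : Config n) → map toℕ (accessible c) ≡ upTo (runLength c)
accessible-indices []          = refl
accessible-indices (true ∷ c)  = refl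
-- (The second line uses that toℕ ∘ Fin.suc and suc ∘ toℕ agree by definition.)
accessible-indices (false ∷ c) = cong (0 ∷_) (begin
  map toℕ (map Fin.suc (accessible c))    ≡⟨ sym (map-∘ (accessible c)) ⟩
  map (suc ∘′ toℕ) (accessible c)          ≡⟨ map-∘ (accessible c) ⟩
  map suc (map toℕ (accessible c))        ≡⟨ cong (map suc) (accessible-indices c) ⟩
  map suc (upTo (runLength c))            ≡⟨ map-upTo suc (runLength c) ⟩
  applyUpTo suc (runLength c)
    ≡⟨ cong (applyUpTo suc) (sym (length-map Fin.suc (accessible c))) ⟩
  applyUpTo suc (length (map Fin.suc (accessible c))) ∎)

record Seating {n} (c : Config n) (t : Fin n) : Set where
  field
    run-cut    : runLength (occupy c t) ≡ toℕ t
    one-more   : occupied (occupy c t) ≡ suc (occupied c)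
    within-run : toℕ t < runLength c

seating : ∀ {n} (c : Config n) → All (Seating c) (accessible c)
seating []          = []
seating (true ∷ c)  = []
seating (false ∷ c) = first-seat ∷ map⁺ (All.map later-seat (seating c))
  where
  first-seat : Seating (false ∷ c) Fin.zero
  first-seat = record { run-cut = refl ; one-more = refl ; within-run = z<s }
  later-seat : ∀ {t} → Seating c t → Seating (false ∷ c) (Fin.suc t)
  later-seat {t} s = record
    { run-cut    = cong suc (trans (length-map Fin.suc (accessible (occupy c t))) (Seating.run-cut s))
    ; one-more   = Seating.one-more s
    ; within-run = s<s (≤-trans (Seating.within-run s)
                                (≤-reflexive (sym (length-map Fin.suc (accessible c)))))
    }

expectedFinal-closed : ∀ f {n} (c : Config n) → runLength c ≤ f →
                       expectedFinal f c ≡ harmonic (runLength c) + ⟦ occupied c ⟧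
expectedFinal-closed zero    c k≤0   rewrite n≤0⇒n≡0 k≤0 = sym (+-identityˡ ⟦ occupied c ⟧)
expectedFinal-closed (suc f) c k≤1+f
  with accessible c | All.map after-seating (seating c) | accessible-indices c
  where
  after-seating : ∀ {t} → Seating c t →
                  expectedFinal f (occupy c t) ≡ harmonic (toℕ t) + ⟦ suc (occupied c) ⟧
  after-seating {t} s = trans
    (expectedFinal-closed f (occupy c t)
      (≤-trans (≤-reflexive (Seating.run-cut s)) (≤-pred (≤-trans (Seating.within-run s) k≤1+f))))
    (cong₂ (λ k o → harmonic k + ⟦ o ⟧) (Seating.run-cut s) (Seating.one-more s))
... | []     | _            | _       = sym (+-identityˡ ⟦ occupied c ⟧)
... | s ∷ ss | after-choice | indices = begin
  (+ 1 / suc (length ss)) * sumℚ (map (λ t → expectedFinal f (occupy c t)) (s ∷ ss))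
    ≡⟨ cong (λ xs → (+ 1 / suc (length ss)) * sumℚ xs) (begin
         map (λ t → expectedFinal f (occupy c t)) (s ∷ ss) ≡⟨ map-cong-local after-choice ⟩
         map (g ∘′ toℕ) (s ∷ ss)                             ≡⟨ map-∘ (s ∷ ss) ⟩
         map g (map toℕ (s ∷ ss))                            ≡⟨ cong (map g) indices ⟩
         map g (upTo (suc (length ss)))                      ∎) ⟩
  (+ 1 / suc (length ss)) * sumℚ (map g (upTo (suc (length ss))))
    ≡⟨ harmonic-average (occupied c) (length ss) ⟩
  harmonic (suc (length ss)) + ⟦ occupied c ⟧ ∎
  where
  g : ℕ → ℚ
  g i = harmonic i + ⟦ suc (occupied c) ⟧

runLength-empty : ∀ n → runLength (replicate n false) ≡ n
runLength-empty zero    = refl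
runLength-empty (suc n) =
  cong suc (trans (length-map Fin.suc (accessible (replicate n false))) (runLength-empty n))

occupied-empty : ∀ n → occupied (replicate n false) ≡ 0
occupied-empty zero    = refl
occupied-empty (suc n) = occupied-empty n

-- Main theorem: the expected number of occupied seats when the process ends
-- is H_n (the argument does not need n ≥ 1, since H_0 = 0).
theorem1 : (n : ℕ) → 1 ≤ n → expectedFinal n (replicate n false) ≡ harmonic n
theorem1 n _ = begin
  expectedFinal n (replicate n false)
    ≡⟨ expectedFinal-closed n (replicate n false) (≤-reflexive (runLength-empty n)) ⟩
  harmonic (runLength (replicate n false)) + ⟦ occupied (replicate n false) ⟧
    ≡⟨ cong₂ (λ k o → harmonic k + ⟦ o ⟧) (runLength-empty n) (occupied-empty n) ⟩
  harmonic n + ⟦ 0 ⟧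
    ≡⟨ +-identityʳ (harmonic n) ⟩
  harmonic n ∎
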